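{- Let $a,b$ be nonnegative integers with $a+b\ge2$, and let $P=\{(x,y)\in\mathbb{Z}^2:0\le y\le a,\ 0\le x\le y+b\}$ with the componentwise order (the $\nu$-Dyck lattice for $\nu=E^aNE^bN$ in these coordinates). Let $c=b-1$ if $b>0$ and $c=0$ if $b=0$. Then every orbit of rowmotion on $P$ contains either one or two elements of the form $(x,a)$ with $c\le x\le a+b-1$.
   Context: $P$ is a finite distributive, hence semidistributive, lattice. Rowmotion on a finite semidistributive lattice $L$ is defined as follows. Let $\mathrm{Pop}^{\downarrow}(x)=x\wedge\bigwedge\{y:y\lessdot x\}$, where the empty meet is the top element. Then $\mathrm{Row}(x)$ is the unique maximal element of $\{y\in L: x\wedge y=\mathrm{Pop}^{\downarrow}(x)\}$. -}

module Defs where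

open import Data.Nat using (ℕ; _≤_; _+_; _∸_)
open import Data.Product using (Σ; ∃; _×_; _,_)
open import Data.Sum using (_⊎_)
open import Relation.Binary.PropositionalEquality using (_≡_)
open import Relation.Nullary using (¬_)

record Pt (a b : ℕ) : Set where
  constructor pt
  field
    px   : ℕ
    py   : ℕ
    py≤a : py ≤ a
    px≤  : px ≤ py + b
open Pt public

module _ {a b : ℕ} where

  _≤P_ : Pt a b → Pt a b → Set
  p ≤P q = (px p ≤ px q) × (py p ≤ py q)

  _≈P_ : Pt a b → Pt a b → Set
  p ≈P q = (px p ≡ px q) × (py p ≡ py q)

  _<P_ : Pt a b → Pt a b → Set
  p <P q = (p ≤P q) × ¬ (q ≤P p)

  _⋖_ : Pt a b → Pt a b → Set
  q ⋖ p = (q <P p) × (∀ w → q <P w → ¬ (w <P p))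

  IsMeet : Pt a b → Pt a b → Pt a b → Set
  IsMeet p q z = (z ≤P p) × (z ≤P q) × (∀ w → w ≤P p → w ≤P q → w ≤P z)

  -- z = Pop↓(p) = p ∧ ⋀{q : q ⋖ p}, i.e. z is the greatest lower bound of
  -- the set {p} ∪ {q : q ⋖ p}
  IsPop : Pt a b → Pt a b → Set
  IsPop p z = (z ≤P p) × (∀ q → q ⋖ p → z ≤P q)
            × (∀ w → w ≤P p → (∀ q → q ⋖ p → w ≤P q) → w ≤P z)

  -- r = Row(p): r is the greatest element of {y : p ∧ y = Pop↓(p)}
  IsRow : Pt a b → Pt a b → Set
  IsRow p r = Σ (Pt a b) λ z → IsPop p z × IsMeet p r z
            × (∀ s → IsMeet p s z → s ≤P r)

  data InOrbit (p : Pt a b) : Pt a b → Set where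
    here : InOrbit p p
    step : ∀ {q r} → InOrbit p q → IsRow q r → InOrbit p r

-- elements of the form (x, a) with c ≤ x ≤ a + b - 1, where c = b - 1 if
-- b > 0 and c = 0 if b = 0 (that is, c = b ∸ 1)
Special : (a b : ℕ) → Pt a b → Set
Special a b p = (py p ≡ a) × (b ∸ 1 ≤ px p) × (px p ≤ a + b ∸ 1)

-- Rowmotion on P is explicit: points with x ≥ 1 and y ≥ 1 strictly left of the boundary
-- diagonal x = y + b move one step down-left along their diagonal, points on the left edge move
-- to the boundary diagonal, and points on the bottom edge or on the boundary diagonal move to
-- the top row. Label each point by the x-coordinate where its diagonal reaches height a + 1
-- (points on the boundary diagonal by their own x-coordinate). Modulo a + 1, every rowmotion
-- step either keeps the label or sends it to a + b minus it, so the labels along an orbit lie in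
-- at most two residue classes. A special point (x, a) has label x + 1, and these labels lie in
-- the window b ≤ x + 1 ≤ a + b of length a + 1, so each residue class carries at most one
-- special point. For existence, the potential (a + 1) x + y decreases under rowmotion except at
-- points on the left edge or the boundary diagonal, from which a special point is reached
-- within a few steps.

module Submission where

open import Defs
open import Data.Nat using (ℕ; zero; suc; _+_; _*_; _∸_; _⊓_; _≤_; _<_; _≟_; _≤?_; _<?_; z≤n; s≤s; s≤s⁻¹)
open import Data.Nat.DivMod using (_%_; %-distribˡ-+; [m+n]%n≡m%n; [m+kn]%n≡m%n; m≤n⇒m%n≡m)
open import Data.Nat.Induction using (<-wellFounded)
open import Data.Nat.Properties
open import Data.Nat.Tactic.RingSolver using (solve-∀)
open import Data.Product using (Σ; _×_; _,_; proj₁; proj₂)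
open import Data.Sum using (_⊎_; inj₁; inj₂)
import Data.Sum as Sum
open import Function using (_∘_)
open import Induction.WellFounded using (Acc; acc)
open import Relation.Nullary using (yes; no; contradiction)
open import Relation.Binary.PropositionalEquality

m⊓n≤o∧o<m⇒n≤o : ∀ {m n o} → m ⊓ n ≤ o → o < m → n ≤ o
m⊓n≤o∧o<m⇒n≤o {m} {n} m⊓n≤o o<m with ⊓-sel m n
... | inj₁ m⊓n≡m = contradiction (subst (_≤ _) m⊓n≡m m⊓n≤o) (<⇒≱ o<m)
... | inj₂ m⊓n≡n = subst (_≤ _) m⊓n≡n m⊓n≤o

+-suc-split : ∀ {m m′ n n′} → m ≤ m′ → n ≤ n′ → suc (m + n) ≡ m′ + n′ →
              (m ≡ m′ × suc n ≡ n′) ⊎ (suc m ≡ m′ × n ≡ n′)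
+-suc-split {m} {m′} {n} {n′} m≤m′ n≤n′ eq with m≤n⇒m<n∨m≡n m≤m′
... | inj₂ refl = inj₁ (refl , +-cancelˡ-≡ m _ _ (trans (+-suc m n) eq))
... | inj₁ m<m′ = inj₂ (m′≡1+m , +-cancelˡ-≡ m′ _ _ (trans (cong (_+ n) (sym m′≡1+m)) eq))
  where
  m′≡1+m : suc m ≡ m′
  m′≡1+m = ≤-antisym m<m′ (+-cancelʳ-≤ n m′ (suc m) (≤-trans (+-monoʳ-≤ m′ n≤n′) (≤-reflexive (sym eq))))

module _ {n : ℕ} where

  %-+-congʳ : ∀ u v k → u % suc n ≡ v % suc n → (u + k) % suc n ≡ (v + k) % suc n
  %-+-congʳ u v k u≡v = begin
    (u + k) % suc n                     ≡⟨ %-distribˡ-+ u k (suc n) ⟩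
    (u % suc n + k % suc n) % suc n     ≡⟨ cong (λ t → (t + k % suc n) % suc n) u≡v ⟩
    (v % suc n + k % suc n) % suc n     ≡⟨ %-distribˡ-+ v k (suc n) ⟨
    (v + k) % suc n                     ∎
    where open ≡-Reasoning

  %-+-congˡ : ∀ u v k → u % suc n ≡ v % suc n → (k + u) % suc n ≡ (k + v) % suc n
  %-+-congˡ u v k u≡v = begin
    (k + u) % suc n  ≡⟨ cong (_% suc n) (+-comm k u) ⟩
    (u + k) % suc n  ≡⟨ %-+-congʳ u v k u≡v ⟩
    (v + k) % suc n  ≡⟨ cong (_% suc n) (+-comm v k) ⟩
    (k + v) % suc n  ∎
    where open ≡-Reasoning

  -- k is cancelled by adding k * n, which completes it to a multiple of n + 1
  %-+-cancelʳ : ∀ u v k → (u + k) % suc n ≡ (v + k) % suc n → u % suc n ≡ v % suc n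
  %-+-cancelʳ u v k u+k≡v+k = begin
    u % suc n                  ≡⟨ [m+kn]%n≡m%n u k (suc n) ⟨
    (u + k * suc n) % suc n    ≡⟨ cong (_% suc n) (shift u) ⟩
    (u + k + k * n) % suc n    ≡⟨ %-+-congʳ (u + k) (v + k) (k * n) u+k≡v+k ⟩
    (v + k + k * n) % suc n    ≡⟨ cong (_% suc n) (shift v) ⟨
    (v + k * suc n) % suc n    ≡⟨ [m+kn]%n≡m%n v k (suc n) ⟩
    v % suc n                  ∎
    where
    open ≡-Reasoning
    shift-identity : ∀ w k n → w + k * suc n ≡ w + k + k * n
    shift-identity = solve-∀
    shift : ∀ w → w + k * suc n ≡ w + k + k * n
    shift w = shift-identity w k n

  %-injective-window : ∀ {lo u v} → lo ≤ u × u ≤ n + lo → lo ≤ v × v ≤ n + lo →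
                       u % suc n ≡ v % suc n → u ≡ v
  %-injective-window {lo} {u} {v} (lo≤u , u≤n+lo) (lo≤v , v≤n+lo) u≡v = begin
    u            ≡⟨ m∸n+n≡m lo≤u ⟨
    u ∸ lo + lo  ≡⟨ cong (_+ lo) offsets-equal ⟩
    v ∸ lo + lo  ≡⟨ m∸n+n≡m lo≤v ⟩
    v            ∎
    where
    open ≡-Reasoning
    reduced : ∀ {w} → w ≤ n + lo → (w ∸ lo) % suc n ≡ w ∸ lo
    reduced w≤n+lo = m≤n⇒m%n≡m (≤-trans (∸-monoˡ-≤ lo w≤n+lo) (≤-reflexive (m+n∸n≡m n lo)))
    shifted : (u ∸ lo + lo) % suc n ≡ (v ∸ lo + lo) % suc n
    shifted = subst₂ (λ s t → s % suc n ≡ t % suc n) (sym (m∸n+n≡m lo≤u)) (sym (m∸n+n≡m lo≤v)) u≡v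
    offsets-equal : u ∸ lo ≡ v ∸ lo
    offsets-equal = begin
      u ∸ lo             ≡⟨ reduced u≤n+lo ⟨
      (u ∸ lo) % suc n   ≡⟨ %-+-cancelʳ (u ∸ lo) (v ∸ lo) lo shifted ⟩
      (v ∸ lo) % suc n   ≡⟨ reduced v≤n+lo ⟩
      v ∸ lo             ∎

-- u ∼ v: v is the image of u under one of the maps t ↦ t, t ↦ c − t of ℤ/(n + 1)
module Dihedral (n c : ℕ) where

  data _∼_ (u v : ℕ) : Set where
    translate : u % suc n ≡ v % suc n → u ∼ v
    reflect   : (u + v) % suc n ≡ c % suc n → u ∼ v

  ∼-reflexive : ∀ {u v} → u ≡ v → u ∼ v
  ∼-reflexive refl = translate refl

  reflect-cancel : ∀ u v w → (u + v) % suc n ≡ c % suc n → (u + w) % suc n ≡ c % suc n →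
                   v % suc n ≡ w % suc n
  reflect-cancel u v w u+v≡c u+w≡c = %-+-cancelʳ v w u (begin
    (v + u) % suc n  ≡⟨ cong (_% suc n) (+-comm v u) ⟩
    (u + v) % suc n  ≡⟨ trans u+v≡c (sym u+w≡c) ⟩
    (u + w) % suc n  ≡⟨ cong (_% suc n) (+-comm u w) ⟩
    (w + u) % suc n  ∎)
    where open ≡-Reasoning

  ∼-trans : ∀ {u v w} → u ∼ v → v ∼ w → u ∼ w
  ∼-trans (translate u≡v) (translate v≡w) = translate (trans u≡v v≡w)
  ∼-trans {u} {v} {w} (translate u≡v) (reflect v+w≡c) = reflect (trans (%-+-congʳ u v w u≡v) v+w≡c)
  ∼-trans {u} {v} {w} (reflect u+v≡c) (translate v≡w) = reflect (trans (sym (%-+-congˡ v w u v≡w)) u+v≡c)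
  ∼-trans {u} {v} {w} (reflect u+v≡c) (reflect v+w≡c) =
    translate (reflect-cancel v u w (trans (cong (_% suc n) (+-comm v u)) u+v≡c) v+w≡c)

  ∼-pigeonhole : ∀ {u v₁ v₂ v₃} → u ∼ v₁ → u ∼ v₂ → u ∼ v₃ →
                 v₁ % suc n ≡ v₂ % suc n ⊎ v₁ % suc n ≡ v₃ % suc n ⊎ v₂ % suc n ≡ v₃ % suc n
  ∼-pigeonhole (translate e₁) (translate e₂) _ = inj₁ (trans (sym e₁) e₂)
  ∼-pigeonhole {u} {v₁} {v₂} (reflect e₁) (reflect e₂) _ = inj₁ (reflect-cancel u v₁ v₂ e₁ e₂)
  ∼-pigeonhole (translate e₁) (reflect _) (translate e₃) = inj₂ (inj₁ (trans (sym e₁) e₃))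
  ∼-pigeonhole {u} {_} {v₂} {v₃} (translate _) (reflect e₂) (reflect e₃) =
    inj₂ (inj₂ (reflect-cancel u v₂ v₃ e₂ e₃))
  ∼-pigeonhole (reflect _) (translate e₂) (translate e₃) = inj₂ (inj₂ (trans (sym e₂) e₃))
  ∼-pigeonhole {u} {v₁} {_} {v₃} (reflect e₁) (translate _) (reflect e₃) =
    inj₂ (inj₁ (reflect-cancel u v₁ v₃ e₁ e₃))

-- Covers, Pop↓ and Row in P

module _ {a b : ℕ} where

  top : Pt a b
  top = pt (a + b) a ≤-refl ≤-refl

  ≤P-top : (p : Pt a b) → p ≤P top
  ≤P-top p = ≤-trans (px≤ p) (+-monoˡ-≤ b (py≤a p)) , py≤a p

  ≤P-trans : ∀ {p q r : Pt a b} → p ≤P q → q ≤P r → p ≤P r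
  ≤P-trans (x≤ , y≤) (x≤′ , y≤′) = ≤-trans x≤ x≤′ , ≤-trans y≤ y≤′

  ≤P-antisym : ∀ {p q : Pt a b} → p ≤P q → q ≤P p → p ≈P q
  ≤P-antisym (x≤ , y≤) (x≥ , y≥) = ≤-antisym x≤ x≥ , ≤-antisym y≤ y≥

  rank : Pt a b → ℕ
  rank p = px p + py p

  <P⇒rank< : ∀ {p q : Pt a b} → p <P q → rank p < rank q
  <P⇒rank< {p} {q} ((x≤ , y≤) , q≰p) with px q ≤? px p
  ... | yes x≥ = +-mono-≤-< x≤ (≰⇒> λ y≥ → q≰p (x≥ , y≥))
  ... | no x≱ = +-mono-<-≤ (≰⇒> x≱) y≤

  rank<⇒<P : ∀ {p q : Pt a b} → p ≤P q → rank p < rank q → p <P q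
  rank<⇒<P p≤q rank< = p≤q , λ (x≥ , y≥) → <⇒≱ rank< (+-mono-≤ x≥ y≥)

  step-toward : ∀ {q p : Pt a b} → q <P p →
                Σ (Pt a b) λ w → q ≤P w × w ≤P p × rank w ≡ suc (rank q)
  step-toward {pt x y ya xb} {p} ((x≤ , y≤) , p≰q) with y <? py p
  ... | yes y< = pt x (suc y) (≤-trans y< (py≤a p)) (≤-trans xb (+-monoˡ-≤ b (n≤1+n y))) ,
                 (≤-refl , n≤1+n y) , (x≤ , y<) , +-suc x y
  ... | no y≮ = pt (suc x) y ya (≤-trans x< (≤-trans (px≤ p) (+-monoˡ-≤ b y≥))) ,
                (n≤1+n x , ≤-refl) , (x< , y≤) , refl
    where
    y≥ : py p ≤ y
    y≥ = ≮⇒≥ y≮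
    x< : x < px p
    x< = ≰⇒> λ x≥ → p≰q (x≥ , y≥)

  ⋖⇒rank : ∀ {q p : Pt a b} → q ⋖ p → suc (rank q) ≡ rank p
  ⋖⇒rank {q} {p} (q<p , nothing-between) with step-toward {q} {p} q<p
  ... | w , q≤w , w≤p , rank-w = ≤-antisym (<P⇒rank< {q} {p} q<p) (≮⇒≥ λ gap →
        nothing-between w (rank<⇒<P {q} {w} q≤w (≤-reflexive (sym rank-w)))
                          (rank<⇒<P {w} {p} w≤p (subst (_< rank p) (sym rank-w) gap)))

  rank⇒⋖ : ∀ {q p : Pt a b} → q ≤P p → suc (rank q) ≡ rank p → q ⋖ p
  rank⇒⋖ {q} {p} q≤p rank-q+1 = rank<⇒<P {q} {p} q≤p (≤-reflexive rank-q+1) , λ w q<w w<p →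
    <⇒≱ (<P⇒rank< {q} {w} q<w) (s≤s⁻¹ (subst (rank w <_) (sym rank-q+1) (<P⇒rank< {w} {p} w<p)))

  data _◃_ : Pt a b → Pt a b → Set where
    left : ∀ {x y ya ya′ xb xb′} → pt x y ya xb ◃ pt (suc x) y ya′ xb′
    down : ∀ {x y ya ya′ xb xb′} → pt x y ya xb ◃ pt x (suc y) ya′ xb′

  ◃⇒⋖ : ∀ {q p : Pt a b} → q ◃ p → q ⋖ p
  ◃⇒⋖ {q} {p} (left {x}) = rank⇒⋖ {q} {p} (n≤1+n x , ≤-refl) refl
  ◃⇒⋖ {q} {p} (down {x} {y}) = rank⇒⋖ {q} {p} (≤-refl , n≤1+n y) (sym (+-suc x y))

  ⋖⇒◃ : ∀ {q p : Pt a b} → q ⋖ p → q ◃ p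
  ⋖⇒◃ {q@(pt _ _ _ _)} {p@(pt _ _ _ _)} q⋖p@(((x≤ , y≤) , _) , _)
    with +-suc-split x≤ y≤ (⋖⇒rank {q} {p} q⋖p)
  ... | inj₁ (refl , refl) = down
  ... | inj₂ (refl , refl) = left

  pop : Pt a b → Pt a b
  pop p@(pt zero zero _ _) = p
  pop (pt (suc x) zero ya xb) = pt x zero ya (<⇒≤ xb)
  pop (pt zero (suc y) ya xb) = pt zero y (<⇒≤ ya) z≤n
  pop (pt (suc x) (suc y) ya xb) with suc x ≤? y + b
  ... | yes x<y+b = pt x y (<⇒≤ ya) (<⇒≤ x<y+b)
  ... | no _ = pt x (suc y) ya (<⇒≤ xb)

  pop-≤ : (p : Pt a b) → pop p ≤P p
  pop-≤ (pt zero zero _ _) = ≤-refl , ≤-refl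
  pop-≤ (pt (suc x) zero _ _) = n≤1+n x , ≤-refl
  pop-≤ (pt zero (suc y) _ _) = ≤-refl , n≤1+n y
  pop-≤ (pt (suc x) (suc y) _ _) with suc x ≤? y + b
  ... | yes _ = n≤1+n x , n≤1+n y
  ... | no _ = n≤1+n x , ≤-refl

  pop-≤-◃ : ∀ {q p : Pt a b} → q ◃ p → pop p ≤P q
  pop-≤-◃ (left {y = zero}) = ≤-refl , ≤-refl
  pop-≤-◃ (left {x} {suc y}) with suc x ≤? y + b
  ... | yes _ = ≤-refl , n≤1+n y
  ... | no _ = ≤-refl , ≤-refl
  pop-≤-◃ (down {zero}) = ≤-refl , ≤-refl
  pop-≤-◃ (down {suc x} {y} {xb = x<y+b}) with suc x ≤? y + b
  ... | yes _ = n≤1+n x , ≤-refl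
  ... | no x≮y+b = contradiction x<y+b x≮y+b

  pop-≤-covers : (p : Pt a b) → ∀ q → q ⋖ p → pop p ≤P q
  pop-≤-covers p q = pop-≤-◃ ∘ ⋖⇒◃ {q} {p}

  pop-greatest : (p w : Pt a b) → w ≤P p → (∀ q → q ⋖ p → w ≤P q) → w ≤P pop p
  pop-greatest p w w≤p below = lower-bound p w≤p λ q → below q ∘ ◃⇒⋖ {q} {p}
    where
    lower-bound : (p : Pt a b) → w ≤P p → (∀ q → q ◃ p → w ≤P q) → w ≤P pop p
    lower-bound (pt zero zero _ _) w≤p _ = w≤p
    lower-bound p@(pt (suc x) zero _ _) _ under = under (pop p) left
    lower-bound p@(pt zero (suc y) _ _) _ under = under (pop p) down
    lower-bound (pt (suc x) (suc y) ya xb) w≤p under with suc x ≤? y + b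
    ... | yes x<y+b = proj₁ (under (pt x (suc y) ya (<⇒≤ xb)) left) ,
                      proj₂ (under (pt (suc x) y (<⇒≤ ya) x<y+b) down)
    ... | no _ = proj₁ (under (pt x (suc y) ya (<⇒≤ xb)) left) , proj₂ w≤p

  pop-isPop : (p : Pt a b) → IsPop p (pop p)
  pop-isPop p = pop-≤ p , pop-≤-covers p , pop-greatest p

  row : Pt a b → Pt a b
  row (pt zero zero _ _) = top
  row (pt (suc x) zero _ xb) = pt x a ≤-refl (≤-trans (<⇒≤ xb) (m≤n+m b a))
  row (pt zero (suc y) ya _) = pt (y + b) y (<⇒≤ ya) ≤-refl
  row (pt (suc x) (suc y) ya xb) with suc x ≤? y + b
  ... | yes x<y+b = pt x y (<⇒≤ ya) (<⇒≤ x<y+b)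
  ... | no _ = pt x a ≤-refl (≤-trans (<⇒≤ xb) (+-monoˡ-≤ b ya))

  pop-isMeet-row : (p : Pt a b) → IsMeet p (row p) (pop p)
  pop-isMeet-row p@(pt zero zero _ _) = pop-≤ p , ≤P-top p , λ _ w≤p _ → w≤p
  pop-isMeet-row p@(pt (suc x) zero _ _) = pop-≤ p , (≤-refl , z≤n) , λ _ w≤p w≤r → proj₁ w≤r , proj₂ w≤p
  pop-isMeet-row p@(pt zero (suc y) _ _) = pop-≤ p , (z≤n , ≤-refl) , λ _ w≤p w≤r → proj₁ w≤p , proj₂ w≤r
  pop-isMeet-row (pt (suc x) (suc y) ya _) with suc x ≤? y + b
  ... | yes _ = (n≤1+n x , n≤1+n y) , (≤-refl , ≤-refl) , λ _ _ w≤r → w≤r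
  ... | no _ = (n≤1+n x , ≤-refl) , (≤-refl , ya) , λ _ w≤p w≤r → proj₁ w≤r , proj₂ w≤p

  infixl 25 _∧_
  _∧_ : Pt a b → Pt a b → Pt a b
  p ∧ q = pt (px p ⊓ px q) (py p ⊓ py q) (≤-trans (m⊓n≤m (py p) (py q)) (py≤a p))
             (subst (px p ⊓ px q ≤_) (sym (+-distribʳ-⊓ b (py p) (py q))) (⊓-mono-≤ (px≤ p) (px≤ q)))

  ∧-≤-meet : ∀ {p q z : Pt a b} → IsMeet p q z → p ∧ q ≤P z
  ∧-≤-meet {p} {q} (_ , _ , greatest) =
    greatest (p ∧ q) (m⊓n≤m (px p) (px q) , m⊓n≤m (py p) (py q)) (m⊓n≤n (px p) (px q) , m⊓n≤n (py p) (py q))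

  isMeet-resp : ∀ {p q z z′ : Pt a b} → z ≤P z′ → z′ ≤P z → IsMeet p q z → IsMeet p q z′
  isMeet-resp {p} {q} {z} {z′} z≤z′ z′≤z (z≤p , z≤q , greatest) =
    ≤P-trans {z′} {z} {p} z′≤z z≤p , ≤P-trans {z′} {z} {q} z′≤z z≤q ,
    λ w w≤p w≤q → ≤P-trans {w} {z} {z′} (greatest w w≤p w≤q) z≤z′

  row-greatest : (p s : Pt a b) → p ∧ s ≤P pop p → s ≤P row p
  row-greatest (pt zero zero _ _) s _ = ≤P-top s
  row-greatest (pt (suc x) zero _ _) s (x⊓≤ , _) = m⊓n≤o∧o<m⇒n≤o x⊓≤ ≤-refl , py≤a s
  row-greatest (pt zero (suc y) _ _) s (_ , y⊓≤) = ≤-trans (px≤ s) (+-monoˡ-≤ b sy≤y) , sy≤y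
    where
    sy≤y : py s ≤ y
    sy≤y = m⊓n≤o∧o<m⇒n≤o y⊓≤ ≤-refl
  row-greatest (pt (suc x) (suc y) _ _) s with suc x ≤? y + b
  ... | yes _ = λ (x⊓≤ , y⊓≤) → m⊓n≤o∧o<m⇒n≤o x⊓≤ ≤-refl , m⊓n≤o∧o<m⇒n≤o y⊓≤ ≤-refl
  ... | no _ = λ (x⊓≤ , _) → m⊓n≤o∧o<m⇒n≤o x⊓≤ ≤-refl , py≤a s

  row-isRow : (p : Pt a b) → IsRow p (row p)
  row-isRow p = pop p , pop-isPop p , pop-isMeet-row p ,
                λ s → row-greatest p s ∘ ∧-≤-meet {p} {s} {pop p}

  row-unique : ∀ {p r : Pt a b} → IsRow p r → r ≈P row p
  row-unique {p} {r} (z , (z≤p , z≤covers , z-greatest) , r-meet , r-greatest) =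
    ≤P-antisym {r} {row p}
      (row-greatest p r (≤P-trans {p ∧ r} {z} {pop p} (∧-≤-meet {p} {r} {z} r-meet) z≤pop))
      (r-greatest (row p) (isMeet-resp {p} {row p} {pop p} {z} pop≤z z≤pop (pop-isMeet-row p)))
    where
    z≤pop : z ≤P pop p
    z≤pop = pop-greatest p z z≤p z≤covers
    pop≤z : pop p ≤P z
    pop≤z = z-greatest (pop p) (pop-≤ p) (pop-≤-covers p)

  orbit-row : (p : Pt a b) → InOrbit p (row p)
  orbit-row p = step here (row-isRow p)

  orbit-trans : ∀ {p q r : Pt a b} → InOrbit p q → InOrbit q r → InOrbit p r
  orbit-trans p↝q here = p↝q
  orbit-trans p↝q (step q↝r r↦s) = step (orbit-trans p↝q q↝r) r↦s

  -- The orbit invariant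

  open Dihedral a (a + b)

  -- Off the boundary diagonal x = y + b: the x-coordinate at which the line of slope 1 through
  -- (x, y) reaches height a + 1. On that diagonal: x itself.
  interceptAt : ℕ → ℕ → ℕ
  interceptAt x y with x ≟ y + b
  ... | yes _ = x
  ... | no _ = x + (suc a ∸ y)

  intercept : Pt a b → ℕ
  intercept p = interceptAt (px p) (py p)

  intercept-cong : ∀ {p q : Pt a b} → p ≈P q → intercept p ≡ intercept q
  intercept-cong (x≡ , y≡) = cong₂ interceptAt x≡ y≡

  intercept-diagonal : ∀ x y → x ≡ y + b → interceptAt x y ≡ x
  intercept-diagonal x y on-diagonal with x ≟ y + b
  ... | yes _ = refl
  ... | no off-diagonal = contradiction on-diagonal off-diagonal

  intercept-off-diagonal : ∀ x y → x ≢ y + b → interceptAt x y ≡ x + (suc a ∸ y)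
  intercept-off-diagonal x y off-diagonal with x ≟ y + b
  ... | yes on-diagonal = contradiction on-diagonal off-diagonal
  ... | no _ = refl

  intercept-bottom : ∀ x → interceptAt x 0 % suc a ≡ x % suc a
  intercept-bottom x with x ≟ 0 + b
  ... | yes _ = refl
  ... | no _ = [m+n]%n≡m%n x (suc a)

  intercept-top : ∀ {x} → x < a + b → interceptAt x a ≡ suc x
  intercept-top {x} x<a+b = begin
    interceptAt x a  ≡⟨ intercept-off-diagonal x a (<⇒≢ x<a+b) ⟩
    x + (suc a ∸ a)  ≡⟨ cong (x +_) (m+n∸n≡m 1 a) ⟩
    x + 1            ≡⟨ +-comm x 1 ⟩
    suc x            ∎
    where open ≡-Reasoning

  intercept-row : (p : Pt a b) → intercept p ∼ intercept (row p)
  intercept-row (pt zero zero _ _) = reflect (begin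
    (interceptAt 0 0 + interceptAt (a + b) a) % suc a  ≡⟨ %-+-congʳ (interceptAt 0 0) 0 _ (intercept-bottom 0) ⟩
    interceptAt (a + b) a % suc a                      ≡⟨ cong (_% suc a) (intercept-diagonal (a + b) a refl) ⟩
    (a + b) % suc a                                    ∎)
    where open ≡-Reasoning
  intercept-row (pt (suc x) zero _ x<b) = translate (begin
    interceptAt (suc x) 0 % suc a  ≡⟨ intercept-bottom (suc x) ⟩
    suc x % suc a                  ≡⟨ cong (_% suc a) (intercept-top (≤-trans x<b (m≤n+m b a))) ⟨
    interceptAt x a % suc a        ∎)
    where open ≡-Reasoning
  intercept-row (pt zero (suc y) y<a _) = reflect (cong (_% suc a) (begin
    interceptAt 0 (suc y) + interceptAt (y + b) y  ≡⟨ cong₂ _+_ (intercept-off-diagonal 0 (suc y) (λ ()))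
                                                                (intercept-diagonal (y + b) y refl) ⟩
    a ∸ y + (y + b)                                ≡⟨ +-assoc (a ∸ y) y b ⟨
    a ∸ y + y + b                                  ≡⟨ cong (_+ b) (m∸n+n≡m (<⇒≤ y<a)) ⟩
    a + b                                          ∎))
    where open ≡-Reasoning
  intercept-row (pt (suc x) (suc y) y<a x≤y+b) with suc x ≤? y + b
  ... | yes x<y+b = ∼-reflexive (begin
    interceptAt (suc x) (suc y)  ≡⟨ intercept-off-diagonal (suc x) (suc y) (<⇒≢ (s≤s x<y+b)) ⟩
    suc x + (a ∸ y)              ≡⟨ +-suc x (a ∸ y) ⟨
    x + suc (a ∸ y)              ≡⟨ cong (x +_) (+-∸-assoc 1 (<⇒≤ y<a)) ⟨
    x + (suc a ∸ y)              ≡⟨ intercept-off-diagonal x y (<⇒≢ x<y+b) ⟨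
    interceptAt x y              ∎)
    where open ≡-Reasoning
  ... | no x≮y+b = ∼-reflexive (begin
    interceptAt (suc x) (suc y)  ≡⟨ intercept-diagonal (suc x) (suc y) on-diagonal ⟩
    suc x                        ≡⟨ intercept-top (≤-trans (≤-reflexive on-diagonal) (+-monoˡ-≤ b y<a)) ⟨
    interceptAt x a              ∎)
    where
    open ≡-Reasoning
    on-diagonal : suc x ≡ suc y + b
    on-diagonal = ≤-antisym x≤y+b (≰⇒> x≮y+b)

  intercept-orbit : ∀ {p q : Pt a b} → InOrbit p q → intercept p ∼ intercept q
  intercept-orbit here = ∼-reflexive refl
  intercept-orbit (step {q} {r} p↝q q↦r) = ∼-trans (intercept-orbit p↝q)
    (subst (intercept q ∼_) (sym (intercept-cong {r} {row q} (row-unique {q} {r} q↦r))) (intercept-row q))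

  special-bounds : ∀ {q : Pt a b} → 1 ≤ a + b → Special a b q → b ≤ suc (px q) × suc (px q) ≤ a + b
  special-bounds 1≤a+b (_ , b∸1≤x , x≤a+b∸1) =
    ≤-trans (m≤n+m∸n b 1) (s≤s b∸1≤x) , ≤-trans (s≤s x≤a+b∸1) (≤-reflexive (m+[n∸m]≡n 1≤a+b))

  special-top : ∀ {q : Pt a b} → py q ≡ a → b ≤ suc (px q) → suc (px q) ≤ a + b → Special a b q
  special-top y≡a b≤x+1 x+1≤a+b = y≡a , ∸-monoˡ-≤ 1 b≤x+1 , ∸-monoˡ-≤ 1 x+1≤a+b

  intercept-special : ∀ {q : Pt a b} → 1 ≤ a + b → Special a b q → intercept q ≡ suc (px q)
  intercept-special {q} 1≤a+b special@(y≡a , _) =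
    trans (cong (interceptAt (px q)) y≡a) (intercept-top (proj₂ (special-bounds {q} 1≤a+b special)))

  special-window : ∀ {q : Pt a b} → 1 ≤ a + b → Special a b q → b ≤ intercept q × intercept q ≤ a + b
  special-window {q} 1≤a+b special =
    subst (λ t → b ≤ t × t ≤ a + b) (sym (intercept-special {q} 1≤a+b special)) (special-bounds {q} 1≤a+b special)

  special-injective : ∀ {q q′ : Pt a b} → 1 ≤ a + b → Special a b q → Special a b q′ →
                      intercept q % suc a ≡ intercept q′ % suc a → q ≈P q′
  special-injective {q} {q′} 1≤a+b s s′ same-residue = suc-injective (begin
    suc (px q)    ≡⟨ intercept-special {q} 1≤a+b s ⟨
    intercept q   ≡⟨ %-injective-window (special-window {q} 1≤a+b s) (special-window {q′} 1≤a+b s′) same-residue ⟩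
    intercept q′  ≡⟨ intercept-special {q′} 1≤a+b s′ ⟩
    suc (px q′)   ∎) , trans (proj₁ s) (sym (proj₁ s′))
    where open ≡-Reasoning

  -- Every orbit meets a special point

  ReachesSpecial : Pt a b → Set
  ReachesSpecial p = Σ (Pt a b) λ q → InOrbit p q × Special a b q

  reaches-row : (p : Pt a b) → ReachesSpecial (row p) → ReachesSpecial p
  reaches-row p (q , row-p↝q , special) = q , orbit-trans (orbit-row p) row-p↝q , special

  row-special⇒reaches : (p : Pt a b) → Special a b (row p) → ReachesSpecial p
  row-special⇒reaches p special = reaches-row p (row p , here , special)

  row-diagonal : (p : Pt a b) → px p ≡ py p + b → 1 ≤ px p → suc (px (row p)) ≡ px p × py (row p) ≡ a
  row-diagonal (pt (suc x) zero _ _) _ _ = refl , refl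
  row-diagonal (pt (suc x) (suc y) _ _) on-diagonal _ with suc x ≤? y + b
  ... | yes x<y+b = contradiction on-diagonal (<⇒≢ (s≤s x<y+b))
  ... | no _ = refl , refl

  row-diagonal-special : (p : Pt a b) → px p ≡ py p + b → 1 ≤ px p → Special a b (row p)
  row-diagonal-special p on-diagonal 1≤x with row-diagonal p on-diagonal 1≤x
  ... | x≡ , y≡a = special-top {row p} y≡a
    (≤-trans (m≤n+m b (py p)) (≤-reflexive (sym (trans x≡ on-diagonal))))
    (≤-trans (≤-reflexive (trans x≡ on-diagonal)) (+-monoˡ-≤ b (py≤a p)))

  origin-reaches : 1 ≤ a + b → (p : Pt a b) → px p ≡ 0 → py p ≡ 0 → ReachesSpecial p
  origin-reaches 1≤a+b p@(pt _ _ _ _) refl refl =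
    reaches-row p (row-special⇒reaches top (row-diagonal-special top refl 1≤a+b))

  diagonal-reaches : 1 ≤ a + b → (p : Pt a b) → px p ≡ py p + b → ReachesSpecial p
  diagonal-reaches 1≤a+b p@(pt zero y _ _) 0≡y+b = origin-reaches 1≤a+b p refl (m+n≡0⇒m≡0 y (sym 0≡y+b))
  diagonal-reaches _ p@(pt (suc _) _ _ _) on-diagonal =
    row-special⇒reaches p (row-diagonal-special p on-diagonal (s≤s z≤n))

  potential : Pt a b → ℕ
  potential p = suc a * px p + py p

  row-progress : 1 ≤ a + b → (p : Pt a b) → ReachesSpecial p ⊎ potential (row p) < potential p
  row-progress 1≤a+b p@(pt zero zero _ _) = inj₁ (origin-reaches 1≤a+b p refl refl)
  row-progress _ (pt (suc x) zero _ _) = inj₂ (begin-strict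
    suc a * x + a      <⟨ +-monoʳ-< (suc a * x) (n<1+n a) ⟩
    suc a * x + suc a  ≡⟨ +-comm (suc a * x) (suc a) ⟩
    suc a + suc a * x  ≡⟨ *-suc (suc a) x ⟨
    suc a * suc x      ≡⟨ +-identityʳ _ ⟨
    suc a * suc x + 0  ∎)
    where open ≤-Reasoning
  row-progress 1≤a+b p@(pt zero (suc y) _ _) =
    inj₁ (reaches-row p (diagonal-reaches 1≤a+b (row p) refl))
  row-progress 1≤a+b p@(pt (suc x) (suc y) _ x≤y+b) with suc x ≤? y + b
  ... | yes _ = inj₂ (+-mono-≤-< (*-monoʳ-≤ (suc a) (n≤1+n x)) (n<1+n y))
  ... | no x≮y+b = inj₁ (diagonal-reaches 1≤a+b p (≤-antisym x≤y+b (≰⇒> x≮y+b)))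

  reaches-special : 1 ≤ a + b → (p : Pt a b) → ReachesSpecial p
  reaches-special 1≤a+b p = go p (<-wellFounded (potential p))
    where
    go : (p : Pt a b) → Acc _<_ (potential p) → ReachesSpecial p
    go p (acc smaller) with row-progress 1≤a+b p
    ... | inj₁ reaches = reaches
    ... | inj₂ decreases = reaches-row p (go (row p) (smaller decreases))

lemma4p12 : (a b : ℕ) → 2 ≤ a + b → (p : Pt a b) →
    (Σ (Pt a b) λ q → InOrbit p q × Special a b q)
    × (∀ q₁ q₂ q₃ → InOrbit p q₁ → InOrbit p q₂ → InOrbit p q₃ →
         Special a b q₁ → Special a b q₂ → Special a b q₃ →
         (q₁ ≈P q₂) ⊎ (q₁ ≈P q₃) ⊎ (q₂ ≈P q₃))
lemma4p12 a b 2≤a+b p = reaches-special 1≤a+b p , at-most-two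
  where
  1≤a+b : 1 ≤ a + b
  1≤a+b = ≤-trans (s≤s z≤n) 2≤a+b
  at-most-two : ∀ q₁ q₂ q₃ → InOrbit p q₁ → InOrbit p q₂ → InOrbit p q₃ →
                Special a b q₁ → Special a b q₂ → Special a b q₃ →
                (q₁ ≈P q₂) ⊎ (q₁ ≈P q₃) ⊎ (q₂ ≈P q₃)
  at-most-two q₁ q₂ q₃ p↝q₁ p↝q₂ p↝q₃ s₁ s₂ s₃ =
    Sum.map (special-injective {q = q₁} {q₂} 1≤a+b s₁ s₂)
            (Sum.map (special-injective {q = q₁} {q₃} 1≤a+b s₁ s₃)
                     (special-injective {q = q₂} {q₃} 1≤a+b s₂ s₃))
      (Dihedral.∼-pigeonhole a (a + b) (intercept-orbit p↝q₁) (intercept-orbit p↝q₂) (intercept-orbit p↝q₃))
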